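{- Let $n\ge1$ and let $S\subseteq\mathbb{Z}_n\setminus\{0\}$ be such that every element of $S$ has order $n$. Then $\Gamma=\mathrm{Circ}(n,S)$ is arc-transitive if and only if $\Gamma$ is normal-arc-transitive (that is, $\mathrm{Aut}(\mathbb{Z}_n,S)$ is transitive on $S$).
   Context: For $S\subseteq\mathbb{Z}_n\setminus\{0\}$, the circulant $\mathrm{Circ}(n,S)=\mathrm{Cay}(\mathbb{Z}_n,S)$ is the digraph with vertex set $\mathbb{Z}_n$ and an arc from $v$ to $w$ iff $w-v\in S$. A digraph is arc-transitive if its automorphism group is transitive on its arcs. $\mathrm{Aut}(\mathbb{Z}_n,S)=\{\sigma\in\mathrm{Aut}(\mathbb{Z}_n):\sigma(S)=S\}$, and $\mathrm{Circ}(n,S)$ is normal-arc-transitive if $\mathrm{Aut}(\mathbb{Z}_n,S)$ is transitive on $S$. -}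

module Defs where

open import Data.Nat using (ℕ; zero; suc; _+_; _*_; _∸_; _<_; NonZero)
open import Data.Nat.DivMod using (_mod_)
open import Data.Fin using (Fin; toℕ)
open import Data.Fin.Subset using (Subset; _∈_; _∉_)
open import Data.Product using (Σ; _×_; _,_)
open import Function.Bundles using (_↔_; Inverse; _⇔_)
open import Relation.Binary.PropositionalEquality using (_≡_; _≢_)

-- ℤ_n is modelled as Fin n (residues 0 … n-1), n ≥ 1.
module _ (n : ℕ) .{{_ : NonZero n}} where

  _⊕_ : Fin n → Fin n → Fin n
  x ⊕ y = (toℕ x + toℕ y) mod n

  _⊖_ : Fin n → Fin n → Fin n
  x ⊖ y = (toℕ x + (n ∸ toℕ y)) mod n

  _·_ : ℕ → Fin n → Fin n
  k · x = (k * toℕ x) mod n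

  𝟘 : Fin n
  𝟘 = 0 mod n

  HasOrder : Fin n → ℕ → Set
  HasOrder x m = (0 < m) × (m · x ≡ 𝟘) × (∀ k → 0 < k → k < m → k · x ≢ 𝟘)

  Arc : Subset n → Fin n → Fin n → Set
  Arc S v w = (w ⊖ v) ∈ S

  IsCircAut : Subset n → (Fin n ↔ Fin n) → Set
  IsCircAut S f = ∀ v w → Arc S v w ⇔ Arc S (Inverse.to f v) (Inverse.to f w)

  ArcTransitive : Subset n → Set
  ArcTransitive S =
    ∀ u v u' v' → Arc S u v → Arc S u' v' →
    Σ (Fin n ↔ Fin n) λ f → IsCircAut S f ×
      (Inverse.to f u ≡ u') × (Inverse.to f v ≡ v')

  IsGroupAut : (Fin n ↔ Fin n) → Set
  IsGroupAut σ = ∀ x y → Inverse.to σ (x ⊕ y) ≡ (Inverse.to σ x ⊕ Inverse.to σ y)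

  IsAutZnS : Subset n → (Fin n ↔ Fin n) → Set
  IsAutZnS S σ = IsGroupAut σ × (∀ x → (x ∈ S) ⇔ (Inverse.to σ x ∈ S))

  NormalArcTransitive : Subset n → Set
  NormalArcTransitive S =
    ∀ s t → s ∈ S → t ∈ S →
    Σ (Fin n ↔ Fin n) λ σ → IsAutZnS S σ × (Inverse.to σ s ≡ t)

module Submission where

open import Defs
open import Data.Nat using (ℕ; NonZero)
open import Data.Fin.Subset using (Subset; _∈_; _∉_)
open import Function.Bundles using (_⇔_; mk⇔)

-- A group automorphism σ with σ(S) = S yields the automorphism x ↦ σ(x − u) + u′ of Circ(n,S),
-- so normal-arc-transitivity implies arc-transitivity.
--
-- Conversely, elements of order n are units of ℤₙ, so for s, t ∈ S there is a unit k with k s = t.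
-- Let χ be the indicator of S in the group semiring ℕ[ℤₙ]. The value χ^l(y − x) counts the walks of
-- length l from x to y, hence is invariant under every automorphism of Γ. For a prime p ∤ n the
-- Frobenius map gives χ^p ≡ χ_{pS} (mod p), so every automorphism of Γ is one of Circ(n,pS), and,
-- factoring k into such primes, one of Circ(n,kS). An automorphism moving the arc (0,t) to (0,w),
-- w ∈ S, therefore shows w ∈ kS, as t = k s ∈ kS. Thus S ⊆ kS and likewise S ⊆ k⁻¹S, so x ↦ k x
-- lies in Aut(ℤₙ,S) and maps s to t.

open import Data.Nat using (zero; suc; _∸_; _<_; z<s; s<s)
import Data.Nat as ℕ
import Data.Nat.Properties as ℕ
open import Data.Nat.Combinatorics using (_C_; nCk+nC[k+1]≡[n+1]C[k+1]; k>n⇒nCk≡0; nC1≡n; nCn≡1)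
open import Data.Nat.Divisibility using (_∣_; divides; ∣⇒≤)
open import Data.Nat.Primality using (Prime; euclidsLemma)
open import Data.Nat.Tactic.RingSolver using (solve-∀)
open import Data.Fin using (Fin; toℕ; inject₁; fromℕ)
import Data.Fin as Fin
open import Data.Fin.Properties using (toℕ-inject₁; toℕ-fromℕ; toℕ<n)
open import Data.Sum using (inj₁; inj₂)
open import Data.Vec.Functional using (Vector; last)
open import Relation.Nullary using (contradiction)
open import Relation.Binary.PropositionalEquality as ≡ using (_≡_; refl; cong; cong₂; subst; module ≡-Reasoning)
open import Algebra.Bundles using (CommutativeSemiring)

module _ where

  open import Data.Nat using (_+_; _*_)
  open import Data.Nat.Properties using (*-zeroʳ; *-identityˡ; *-identityʳ; *-comm; +-comm; <⇒≱)
  open ≡ using (sym; trans)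

  suc-*-C : ∀ m k → suc k * (suc m C suc k) ≡ suc m * (m C k)
  suc-*-C zero zero = refl
  suc-*-C zero (suc k) = begin
      suc (suc k) * (1 C suc (suc k)) ≡⟨ cong (suc (suc k) *_) (k>n⇒nCk≡0 {1} {suc (suc k)} (s<s z<s)) ⟩
      suc (suc k) * 0                 ≡⟨ *-zeroʳ (suc (suc k)) ⟩
      0                               ≡⟨ k>n⇒nCk≡0 {0} {suc k} z<s ⟨
      0 C suc k                       ≡⟨ *-identityˡ (0 C suc k) ⟨
      1 * (0 C suc k)                 ∎
    where open ≡-Reasoning
  suc-*-C (suc m) zero = trans (*-identityˡ _) (trans (nC1≡n (suc (suc m))) (sym (*-identityʳ _)))
  suc-*-C (suc m) (suc k) = begin
      suc (suc k) * (suc (suc m) C suc (suc k))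
        ≡⟨ cong (suc (suc k) *_) (nCk+nC[k+1]≡[n+1]C[k+1] (suc m) (suc k)) ⟨
      suc (suc k) * (A + B)
        ≡⟨ expand k A B ⟩
      (suc k * A + A) + suc (suc k) * B
        ≡⟨ cong₂ (λ x y → (x + A) + y) (suc-*-C m k) (suc-*-C m (suc k)) ⟩
      (suc m * (m C k) + A) + suc m * (m C suc k)
        ≡⟨ collect m (m C k) A (m C suc k) ⟩
      suc m * (m C k + m C suc k) + A
        ≡⟨ cong (λ x → suc m * x + A) (nCk+nC[k+1]≡[n+1]C[k+1] m k) ⟩
      suc m * A + A
        ≡⟨ +-comm (suc m * A) A ⟩
      suc (suc m) * A ∎
    where
    open ≡-Reasoning
    A = suc m C suc k
    B = suc m C suc (suc k)
    expand : ∀ k A B → suc (suc k) * (A + B) ≡ (suc k * A + A) + suc (suc k) * B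
    expand = solve-∀
    collect : ∀ m X A Y → (suc m * X + A) + suc m * Y ≡ suc m * (X + Y) + A
    collect = solve-∀

  prime∣C : ∀ {p k} → Prime p → 0 < k → k < p → p ∣ p C k
  prime∣C {suc m} {suc k} p-prime _ k<p
    with euclidsLemma (suc k) (suc m C suc k) p-prime
           (divides (m C k) (trans (suc-*-C m k) (*-comm (suc m) (m C k))))
  ... | inj₂ p∣C = p∣C
  ... | inj₁ p∣k = contradiction (∣⇒≤ p∣k) (<⇒≱ k<p)

module Frobenius {c ℓ} (R : CommutativeSemiring c ℓ) where

  open CommutativeSemiring R hiding (refl)
  open import Algebra.Properties.Semiring.Exp semiring using (_^_; ^-congʳ)
  open import Algebra.Properties.Monoid.Mult +-monoid using (_×_; ×-congˡ; ×-homo-1; ×-assocˡ)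
  open import Algebra.Properties.Monoid.Sum +-monoid using (sum; sum-init-last; sum-cong-≋; sum-replicate-zero)
  import Algebra.Properties.CommutativeSemiring.Binomial R as Binomial
  open import Relation.Binary.Reasoning.Setoid setoid

  sum-≈0# : ∀ {k} (t : Vector Carrier k) → (∀ i → t i ≈ 0#) → sum t ≈ 0#
  sum-≈0# {k} t t≈0 = trans (sum-cong-≋ t≈0) (sum-replicate-zero k)

  freshmans-dream :
    ∀ m → (∀ k → 0 < k → k < suc m → ∀ z → (suc m C k) × z ≈ 0#) →
    ∀ x y → (x + y) ^ suc m ≈ x ^ suc m + y ^ suc m
  freshmans-dream m vanish x y = begin
      (x + y) ^ q                              ≈⟨ Binomial.theorem q x y ⟩
      sum t                                    ≈⟨ sum-init-last t ⟩
      (t Fin.zero + sum middle) + last t       ≈⟨ +-congʳ (+-congˡ (sum-≈0# middle middle≈0)) ⟩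
      (t Fin.zero + 0#) + last t               ≈⟨ +-congʳ (+-identityʳ (t Fin.zero)) ⟩
      t Fin.zero + last t                      ≈⟨ +-comm (t Fin.zero) (last t) ⟩
      last t + t Fin.zero                      ≈⟨ +-cong (lastTerm (toℕ (fromℕ q)) (toℕ-fromℕ q)) firstTerm ⟩
      x ^ q + y ^ q                            ∎
    where
    q = suc m
    t = Binomial.binomialTerm x y q
    middle : Vector Carrier m
    middle i = t (Fin.suc (inject₁ i))
    middle≈0 : ∀ i → middle i ≈ 0#
    middle≈0 i = vanish (suc (toℕ (inject₁ i))) z<s
                   (s<s (subst (_< m) (≡.sym (toℕ-inject₁ i)) (toℕ<n i))) _
    firstTerm : t Fin.zero ≈ y ^ q
    firstTerm = trans (×-homo-1 _) (*-identityˡ (y ^ q))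
    lastTerm : ∀ k → k ≡ q → (q C k) × (x ^ k * y ^ (q ∸ k)) ≈ x ^ q
    lastTerm .q refl = begin
      (q C q) × (x ^ q * y ^ (q ∸ q))   ≈⟨ ×-congˡ (nCn≡1 q) ⟩
      1 × (x ^ q * y ^ (q ∸ q))         ≈⟨ ×-homo-1 _ ⟩
      x ^ q * y ^ (q ∸ q)               ≈⟨ *-congˡ (^-congʳ y (ℕ.n∸n≡0 q)) ⟩
      x ^ q * 1#                        ≈⟨ *-identityʳ (x ^ q) ⟩
      x ^ q                             ∎

  multiple-×≈0# : ∀ {p c} → (∀ z → p × z ≈ 0#) → p ∣ c → ∀ z → c × z ≈ 0#
  multiple-×≈0# {p} p×≈0# (divides d refl) z = begin
    (d ℕ.* p) × z  ≈⟨ ×-congˡ (ℕ.*-comm d p) ⟩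
    (p ℕ.* d) × z  ≈⟨ ×-assocˡ z p d ⟨
    p × (d × z)    ≈⟨ p×≈0# (d × z) ⟩
    0#             ∎

  frobenius : ∀ {p} → Prime p → (∀ z → p × z ≈ 0#) → ∀ x y → (x + y) ^ p ≈ x ^ p + y ^ p
  frobenius {suc m} p-prime p×≈0# = freshmans-dream m
    (λ k 0<k k<p → multiple-×≈0# p×≈0# (prime∣C p-prime 0<k k<p))

  frobenius-sum : ∀ {p} → Prime p → (∀ z → p × z ≈ 0#) →
                  ∀ {k} (t : Vector Carrier k) → sum t ^ p ≈ sum (λ i → t i ^ p)
  frobenius-sum {suc m} p-prime p×≈0# {zero} t = zeroˡ _
  frobenius-sum {p} p-prime p×≈0# {suc k} t = begin
    (t Fin.zero + sum (λ i → t (Fin.suc i))) ^ p          ≈⟨ frobenius p-prime p×≈0# (t Fin.zero) _ ⟩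
    t Fin.zero ^ p + sum (λ i → t (Fin.suc i)) ^ p        ≈⟨ +-congˡ (frobenius-sum p-prime p×≈0# (λ i → t (Fin.suc i))) ⟩
    t Fin.zero ^ p + sum (λ i → t (Fin.suc i) ^ p)        ∎

open import Data.Nat
  using (pred; _+_; _*_; _%_; _≤_; z≤n; s≤s; s≤s⁻¹; nonTrivial⇒n>1; ≢-nonZero⁻¹; >-nonZero⁻¹; >-nonZero)
open import Data.Nat.Properties
open import Data.Nat.DivMod using (_mod_; %-distribˡ-+; %-distribˡ-*; m%n%n≡m%n; [m+n]%n≡m%n; m<n⇒m%n≡m; m%n<n)
open import Data.Nat.Coprimality using (Coprime; coprime-Bézout)
open import Data.Nat.GCD using (module Bézout)
open import Data.Nat.Primality using (prime⇒nonZero; prime⇒nonTrivial)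
open import Data.Nat.Primality.Factorisation using (factorise; PrimeFactorisation)
open import Data.Nat.ListAction using (product)
open import Data.List using ([]; _∷_)
open import Data.List.Relation.Unary.All using (All; []; _∷_)
open import Data.Fin using (punchIn)
open import Data.Fin.Properties using (toℕ-injective; toℕ-fromℕ<; punchInᵢ≢i; any?) renaming (_≟_ to _≟ᶠ_)
open import Data.Fin.Subset.Properties using (_∈?_)
open import Data.Product using (Σ; ∃; _×_; _,_; proj₁; proj₂)
open import Function.Bundles using (_↔_; Inverse; Injection; Equivalence; mk↔ₛ′)
open import Function.Properties.Inverse using (↔⇒↣)
open import Function.Base using (_∘_)
open import Relation.Nullary using (Dec; yes; no)
open import Relation.Nullary.Decidable using (_×-dec_)
open import Relation.Binary.PropositionalEquality
open import Relation.Binary.Bundles using (Setoid)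
import Relation.Binary.Reasoning.Setoid as SetoidReasoning
open import Algebra.Structures.Biased using (isCommutativeMonoidˡ; IsCommutativeSemiringˡ)
import Algebra.Construct.Pointwise as Pointwise
open import Algebra.Properties.CommutativeMonoid.Sum +-0-commutativeMonoid
  using (sum; sum-remove; ∑-comm; ∑-permute; ∑-distrib-+; sum-cong-≗; sum-replicate-zero)
open import Algebra.Properties.Semiring.Sum +-*-semiring using (*-distribˡ-sum; *-distribʳ-sum)
open import Level using (0ℓ)

module Congruence (m : ℕ) .{{_ : NonZero m}} where

  -- A record rather than a definition, so that a and b can be inferred from a ≋ b.
  infix 4 _≋_
  record _≋_ (a b : ℕ) : Set where
    constructor mk≋
    field %≡% : a % m ≡ b % m
  open _≋_ public

  ≋-setoid : Setoid _ _
  ≋-setoid = record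
    { Carrier = ℕ
    ; _≈_ = _≋_
    ; isEquivalence = record
      { refl = mk≋ refl
      ; sym = λ p → mk≋ (sym (%≡% p))
      ; trans = λ p q → mk≋ (trans (%≡% p) (%≡% q)) } }

  open Setoid ≋-setoid public using () renaming (refl to ≋-refl; sym to ≋-sym; trans to ≋-trans)
  module ≋-Reasoning = SetoidReasoning ≋-setoid

  ≡⇒≋ : ∀ {a b} → a ≡ b → a ≋ b
  ≡⇒≋ refl = ≋-refl

  %-≋ : ∀ a → a % m ≋ a
  %-≋ a = mk≋ (m%n%n≡m%n a m)

  +-cong-≋ : ∀ {a b c d} → a ≋ b → c ≋ d → a + c ≋ b + d
  +-cong-≋ {a} {b} {c} {d} (mk≋ p) (mk≋ q) = mk≋ (begin
    (a + c) % m         ≡⟨ %-distribˡ-+ a c m ⟩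
    (a % m + c % m) % m ≡⟨ cong₂ (λ x y → (x + y) % m) p q ⟩
    (b % m + d % m) % m ≡⟨ %-distribˡ-+ b d m ⟨
    (b + d) % m         ∎)
    where open ≡-Reasoning

  *-cong-≋ : ∀ {a b c d} → a ≋ b → c ≋ d → a * c ≋ b * d
  *-cong-≋ {a} {b} {c} {d} (mk≋ p) (mk≋ q) = mk≋ (begin
    (a * c) % m           ≡⟨ %-distribˡ-* a c m ⟩
    (a % m * (c % m)) % m ≡⟨ cong₂ (λ x y → (x * y) % m) p q ⟩
    (b % m * (d % m)) % m ≡⟨ %-distribˡ-* b d m ⟨
    (b * d) % m           ∎)
    where open ≡-Reasoning

  +-congˡ-≋ : ∀ a {c d} → c ≋ d → a + c ≋ a + d
  +-congˡ-≋ a = +-cong-≋ (≋-refl {a})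

  +-congʳ-≋ : ∀ {a b} c → a ≋ b → a + c ≋ b + c
  +-congʳ-≋ c p = +-cong-≋ p (≋-refl {c})

  m≋0 : m ≋ 0
  m≋0 = mk≋ ([m+n]%n≡m%n 0 m)

  a+m≋a : ∀ a → a + m ≋ a
  a+m≋a a = mk≋ ([m+n]%n≡m%n a m)

  +-cancelʳ-≋ : ∀ a b c → a + c ≋ b + c → a ≋ b
  +-cancelʳ-≋ a b c p = begin
      a                 ≈⟨ shift a ⟨
      a + c + (m ∸ c′)  ≈⟨ +-congʳ-≋ (m ∸ c′) p ⟩
      b + c + (m ∸ c′)  ≈⟨ shift b ⟩
      b                 ∎
    where
    open ≋-Reasoning
    c′ = c % m
    shift : ∀ x → x + c + (m ∸ c′) ≋ x
    shift x = begin
      x + c + (m ∸ c′)   ≡⟨ +-assoc x c (m ∸ c′) ⟩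
      x + (c + (m ∸ c′)) ≈⟨ +-congˡ-≋ x (+-congʳ-≋ (m ∸ c′) (%-≋ c)) ⟨
      x + (c′ + (m ∸ c′)) ≡⟨ cong (x +_) (m+[n∸m]≡n (<⇒≤ (m%n<n c m))) ⟩
      x + m              ≈⟨ a+m≋a x ⟩
      x                  ∎

  ≋⇒≡ : ∀ {a b} → a < m → b < m → a ≋ b → a ≡ b
  ≋⇒≡ {a} {b} a<m b<m (mk≋ p) = trans (sym (m<n⇒m%n≡m a<m)) (trans p (m<n⇒m%n≡m b<m))

module ZMod (n : ℕ) .{{_ : NonZero n}} where

  open Congruence n public

  infixl 6 _⊞_ _⊟_
  infixr 7 _∙_

  _⊞_ : Fin n → Fin n → Fin n
  _⊞_ = _⊕_ n

  _⊟_ : Fin n → Fin n → Fin n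
  _⊟_ = _⊖_ n

  _∙_ : ℕ → Fin n → Fin n
  _∙_ = _·_ n

  0ₙ : Fin n
  0ₙ = 𝟘 n

  toℕ-mod : ∀ a → toℕ (a mod n) ≋ a
  toℕ-mod a = ≋-trans (≡⇒≋ (toℕ-fromℕ< _)) (%-≋ a)

  toℕ-injective-≋ : ∀ {x y : Fin n} → toℕ x ≋ toℕ y → x ≡ y
  toℕ-injective-≋ {x} {y} p = toℕ-injective (≋⇒≡ (toℕ<n x) (toℕ<n y) p)

  toℕ-⊞ : ∀ x y → toℕ (x ⊞ y) ≋ toℕ x + toℕ y
  toℕ-⊞ x y = toℕ-mod _

  toℕ-∙ : ∀ k x → toℕ (k ∙ x) ≋ k * toℕ x
  toℕ-∙ k x = toℕ-mod _

  toℕ-0ₙ : toℕ 0ₙ ≡ 0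
  toℕ-0ₙ = ≋⇒≡ (toℕ<n 0ₙ) (>-nonZero⁻¹ n) (toℕ-mod 0)

  toℕ-⊟ : ∀ x y → toℕ (x ⊟ y) + toℕ y ≋ toℕ x
  toℕ-⊟ x y = begin
      toℕ (x ⊟ y) + toℕ y             ≈⟨ +-congʳ-≋ (toℕ y) (toℕ-mod _) ⟩
      toℕ x + (n ∸ toℕ y) + toℕ y     ≡⟨ +-assoc (toℕ x) _ (toℕ y) ⟩
      toℕ x + (n ∸ toℕ y + toℕ y)     ≡⟨ cong (toℕ x +_) (m∸n+n≡m (<⇒≤ (toℕ<n y))) ⟩
      toℕ x + n                       ≈⟨ a+m≋a (toℕ x) ⟩
      toℕ x                           ∎
    where open ≋-Reasoning

  ⊟-unique : ∀ {x y z} → toℕ z + toℕ y ≋ toℕ x → x ⊟ y ≡ z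
  ⊟-unique {x} {y} {z} p = toℕ-injective-≋
    (+-cancelʳ-≋ _ _ (toℕ y) (≋-trans (toℕ-⊟ x y) (≋-sym p)))

  ⊞-comm : ∀ x y → x ⊞ y ≡ y ⊞ x
  ⊞-comm x y = toℕ-injective-≋ (begin
      toℕ (x ⊞ y)      ≈⟨ toℕ-⊞ x y ⟩
      toℕ x + toℕ y    ≡⟨ +-comm (toℕ x) (toℕ y) ⟩
      toℕ y + toℕ x    ≈⟨ toℕ-⊞ y x ⟨
      toℕ (y ⊞ x)      ∎)
    where open ≋-Reasoning

  ⊞-identityˡ : ∀ x → 0ₙ ⊞ x ≡ x
  ⊞-identityˡ x = toℕ-injective-≋ (≋-trans (toℕ-⊞ 0ₙ x) (≡⇒≋ (cong (_+ toℕ x) toℕ-0ₙ)))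

  ⊟-identityʳ : ∀ x → x ⊟ 0ₙ ≡ x
  ⊟-identityʳ x = ⊟-unique (≡⇒≋ (trans (cong (toℕ x +_) toℕ-0ₙ) (+-identityʳ (toℕ x))))

  ⊟-self : ∀ x → x ⊟ x ≡ 0ₙ
  ⊟-self x = ⊟-unique (≡⇒≋ (cong (_+ toℕ x) toℕ-0ₙ))

  x⊟y⊞y≡x : ∀ x y → x ⊟ y ⊞ y ≡ x
  x⊟y⊞y≡x x y = toℕ-injective-≋ (≋-trans (toℕ-⊞ (x ⊟ y) y) (toℕ-⊟ x y))

  y⊞[x⊟y]≡x : ∀ x y → y ⊞ (x ⊟ y) ≡ x
  y⊞[x⊟y]≡x x y = trans (⊞-comm y (x ⊟ y)) (x⊟y⊞y≡x x y)

  x⊞y⊟y≡x : ∀ x y → x ⊞ y ⊟ y ≡ x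
  x⊞y⊟y≡x x y = ⊟-unique (≋-sym (toℕ-⊞ x y))

  y⊞x⊟y≡x : ∀ x y → y ⊞ x ⊟ y ≡ x
  y⊞x⊟y≡x x y = trans (cong (_⊟ y) (⊞-comm y x)) (x⊞y⊟y≡x x y)

  x⊟[x⊟y]≡y : ∀ x y → x ⊟ (x ⊟ y) ≡ y
  x⊟[x⊟y]≡y x y = ⊟-unique (≋-trans (≡⇒≋ (+-comm (toℕ y) _)) (toℕ-⊟ x y))

  ⊟≡0ₙ⇒≡ : ∀ {x y} → x ⊟ y ≡ 0ₙ → x ≡ y
  ⊟≡0ₙ⇒≡ {x} {y} p = begin
      x              ≡⟨ x⊟y⊞y≡x x y ⟨
      x ⊟ y ⊞ y      ≡⟨ cong (_⊞ y) p ⟩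
      0ₙ ⊞ y         ≡⟨ ⊞-identityˡ y ⟩
      y              ∎
    where open ≡-Reasoning

  x⊟[y⊞z]≡x⊟y⊟z : ∀ x y z → x ⊟ (y ⊞ z) ≡ x ⊟ y ⊟ z
  x⊟[y⊞z]≡x⊟y⊟z x y z = ⊟-unique (begin
      toℕ w + toℕ (y ⊞ z)          ≈⟨ +-congˡ-≋ (toℕ w) (toℕ-⊞ y z) ⟩
      toℕ w + (toℕ y + toℕ z)      ≡⟨ cong (toℕ w +_) (+-comm (toℕ y) (toℕ z)) ⟩
      toℕ w + (toℕ z + toℕ y)      ≡⟨ +-assoc (toℕ w) (toℕ z) (toℕ y) ⟨
      toℕ w + toℕ z + toℕ y        ≈⟨ +-congʳ-≋ (toℕ y) (toℕ-⊟ (x ⊟ y) z) ⟩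
      toℕ (x ⊟ y) + toℕ y          ≈⟨ toℕ-⊟ x y ⟩
      toℕ x                        ∎)
    where
    open ≋-Reasoning
    w = x ⊟ y ⊟ z

  x⊞z⊟[y⊞z]≡x⊟y : ∀ x y z → x ⊞ z ⊟ (y ⊞ z) ≡ x ⊟ y
  x⊞z⊟[y⊞z]≡x⊟y x y z = ⊟-unique (begin
      toℕ (x ⊟ y) + toℕ (y ⊞ z)       ≈⟨ +-congˡ-≋ (toℕ (x ⊟ y)) (toℕ-⊞ y z) ⟩
      toℕ (x ⊟ y) + (toℕ y + toℕ z)   ≡⟨ +-assoc (toℕ (x ⊟ y)) (toℕ y) (toℕ z) ⟨
      toℕ (x ⊟ y) + toℕ y + toℕ z     ≈⟨ +-congʳ-≋ (toℕ z) (toℕ-⊟ x y) ⟩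
      toℕ x + toℕ z                   ≈⟨ toℕ-⊞ x z ⟨
      toℕ (x ⊞ z)                     ∎)
    where open ≋-Reasoning

  [y⊟x]⊟[z⊟x]≡y⊟z : ∀ x y z → (y ⊟ x) ⊟ (z ⊟ x) ≡ y ⊟ z
  [y⊟x]⊟[z⊟x]≡y⊟z x y z = begin
      (y ⊟ x) ⊟ (z ⊟ x)           ≡⟨ x⊞z⊟[y⊞z]≡x⊟y (y ⊟ x) (z ⊟ x) x ⟨
      y ⊟ x ⊞ x ⊟ (z ⊟ x ⊞ x)     ≡⟨ cong₂ _⊟_ (x⊟y⊞y≡x y x) (x⊟y⊞y≡x z x) ⟩
      y ⊟ z                       ∎
    where open ≡-Reasoning

  ∙-assoc : ∀ k l x → k ∙ (l ∙ x) ≡ (k * l) ∙ x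
  ∙-assoc k l x = toℕ-injective-≋ (begin
      toℕ (k ∙ (l ∙ x))     ≈⟨ toℕ-∙ k (l ∙ x) ⟩
      k * toℕ (l ∙ x)       ≈⟨ *-cong-≋ (≋-refl {k}) (toℕ-∙ l x) ⟩
      k * (l * toℕ x)       ≡⟨ *-assoc k l (toℕ x) ⟨
      k * l * toℕ x         ≈⟨ toℕ-∙ (k * l) x ⟨
      toℕ ((k * l) ∙ x)     ∎)
    where open ≋-Reasoning

  ∙-identityˡ : ∀ x → 1 ∙ x ≡ x
  ∙-identityˡ x = toℕ-injective-≋ (≋-trans (toℕ-∙ 1 x) (≡⇒≋ (*-identityˡ (toℕ x))))

  ∙-distribˡ-⊞ : ∀ k x y → k ∙ (x ⊞ y) ≡ k ∙ x ⊞ k ∙ y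
  ∙-distribˡ-⊞ k x y = toℕ-injective-≋ (begin
      toℕ (k ∙ (x ⊞ y))               ≈⟨ toℕ-∙ k (x ⊞ y) ⟩
      k * toℕ (x ⊞ y)                 ≈⟨ *-cong-≋ (≋-refl {k}) (toℕ-⊞ x y) ⟩
      k * (toℕ x + toℕ y)             ≡⟨ *-distribˡ-+ k (toℕ x) (toℕ y) ⟩
      k * toℕ x + k * toℕ y           ≈⟨ +-cong-≋ (toℕ-∙ k x) (toℕ-∙ k y) ⟨
      toℕ (k ∙ x) + toℕ (k ∙ y)       ≈⟨ toℕ-⊞ (k ∙ x) (k ∙ y) ⟨
      toℕ (k ∙ x ⊞ k ∙ y)             ∎)
    where open ≋-Reasoning

  suc-∙ : ∀ k x → suc k ∙ x ≡ x ⊞ k ∙ x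
  suc-∙ k x = toℕ-injective-≋ (begin
      toℕ (suc k ∙ x)          ≈⟨ toℕ-∙ (suc k) x ⟩
      toℕ x + k * toℕ x        ≈⟨ +-congˡ-≋ (toℕ x) (toℕ-∙ k x) ⟨
      toℕ x + toℕ (k ∙ x)      ≈⟨ toℕ-⊞ x (k ∙ x) ⟨
      toℕ (x ⊞ k ∙ x)          ∎)
    where open ≋-Reasoning

  Unit : ℕ → Set
  Unit k = ∃ λ u → u * k ≋ 1

  ∙-inverse : ∀ u k → u * k ≋ 1 → ∀ x → u ∙ (k ∙ x) ≡ x
  ∙-inverse u k uk≋1 x = trans (∙-assoc u k x) (toℕ-injective-≋ (begin
      toℕ ((u * k) ∙ x)   ≈⟨ toℕ-∙ (u * k) x ⟩
      u * k * toℕ x       ≈⟨ *-cong-≋ uk≋1 (≋-refl {toℕ x}) ⟩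
      1 * toℕ x           ≡⟨ *-identityˡ (toℕ x) ⟩
      toℕ x               ∎))
    where open ≋-Reasoning

  unit-inverse : ∀ {k} (ku : Unit k) → Unit (proj₁ ku)
  unit-inverse {k} (u , uk≋1) = k , ≋-trans (≡⇒≋ (*-comm k u)) uk≋1

  ∙-↔ : ∀ {k} → Unit k → Fin n ↔ Fin n
  ∙-↔ {k} ku@(u , uk≋1) = mk↔ₛ′ (k ∙_) (u ∙_) (∙-inverse k u (proj₂ (unit-inverse ku))) (∙-inverse u k uk≋1)

  ⊞-↔ : Fin n → Fin n ↔ Fin n
  ⊞-↔ y = mk↔ₛ′ (y ⊞_) (_⊟ y) (λ x → y⊞[x⊟y]≡x x y) (λ x → y⊞x⊟y≡x x y)

  ⊟-↔ : Fin n → Fin n ↔ Fin n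
  ⊟-↔ y = mk↔ₛ′ (_⊟ y) (_⊞ y) (λ x → x⊞y⊟y≡x x y) (λ x → x⊟y⊞y≡x x y)

  reflect-↔ : Fin n → Fin n ↔ Fin n
  reflect-↔ x = mk↔ₛ′ (x ⊟_) (x ⊟_) (x⊟[x⊟y]≡y x) (x⊟[x⊟y]≡y x)

  Scaled : ℕ → (Fin n → Set) → Fin n → Set
  Scaled k P v = ∃ λ d → P d × k ∙ d ≡ v

  Scaled? : ∀ k {P : Fin n → Set} → (∀ v → Dec (P v)) → ∀ v → Dec (Scaled k P v)
  Scaled? k P? v = any? (λ d → P? d ×-dec (k ∙ d ≟ᶠ v))

  Scaled-unit⇔ : ∀ {k} (ku : Unit k) {P : Fin n → Set} v → P (proj₁ ku ∙ v) ⇔ Scaled k P v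
  Scaled-unit⇔ {k} ku@(u , uk≋1) {P} v = mk⇔
    (λ P[uv] → u ∙ v , P[uv] , ∙-inverse k u (proj₂ (unit-inverse ku)) v)
    (λ { (d , Pd , kd≡v) → subst P (trans (sym (∙-inverse u k uk≋1 d)) (cong (u ∙_) kd≡v)) Pd })

  Scaled-identity : ∀ {P : Fin n → Set} v → P v ⇔ Scaled 1 P v
  Scaled-identity {P} v = mk⇔ (λ Pv → v , Pv , ∙-identityˡ v)
    (λ { (d , Pd , 1d≡v) → subst P (trans (sym (∙-identityˡ d)) 1d≡v) Pd })

  Scaled-assoc : ∀ k l {P : Fin n → Set} v → Scaled k (Scaled l P) v ⇔ Scaled (k * l) P v
  Scaled-assoc k l v = mk⇔
    (λ { (_ , (d , Pd , refl) , kld≡v) → d , Pd , trans (sym (∙-assoc k l d)) kld≡v })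
    (λ { (d , Pd , kld≡v) → l ∙ d , (d , Pd , refl) , trans (∙-assoc k l d) kld≡v })

  ⊟-hom : ∀ (σ : Fin n ↔ Fin n) → IsGroupAut n σ → ∀ a b → Inverse.to σ (a ⊟ b) ≡ Inverse.to σ a ⊟ Inverse.to σ b
  ⊟-hom σ σ-hom a b = begin
      σ→ (a ⊟ b)                ≡⟨ x⊞y⊟y≡x (σ→ (a ⊟ b)) (σ→ b) ⟨
      σ→ (a ⊟ b) ⊞ σ→ b ⊟ σ→ b  ≡⟨ cong (_⊟ σ→ b) (σ-hom (a ⊟ b) b) ⟨
      σ→ (a ⊟ b ⊞ b) ⊟ σ→ b     ≡⟨ cong (λ x → σ→ x ⊟ σ→ b) (x⊟y⊞y≡x a b) ⟩
      σ→ a ⊟ σ→ b               ∎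
    where
    open ≡-Reasoning
    σ→ = Inverse.to σ

  affine-↔ : (Fin n ↔ Fin n) → Fin n → Fin n → Fin n ↔ Fin n
  affine-↔ σ u u′ = mk↔ₛ′ (λ x → to (x ⊟ u) ⊞ u′) (λ y → from (y ⊟ u′) ⊞ u)
    (λ y → trans (cong (λ z → to z ⊞ u′) (x⊞y⊟y≡x _ u))
             (trans (cong (_⊞ u′) (strictlyInverseˡ _)) (x⊟y⊞y≡x y u′)))
    (λ x → trans (cong (λ z → from z ⊞ u) (x⊞y⊟y≡x _ u′))
             (trans (cong (_⊞ u) (strictlyInverseʳ _)) (x⊟y⊞y≡x x u)))
    where open Inverse σ

  affine-⊟ : ∀ σ u u′ → IsGroupAut n σ → ∀ x y →
             Inverse.to (affine-↔ σ u u′) y ⊟ Inverse.to (affine-↔ σ u u′) x ≡ Inverse.to σ (y ⊟ x)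
  affine-⊟ σ u u′ σ-hom x y = begin
      σ→ (y ⊟ u) ⊞ u′ ⊟ (σ→ (x ⊟ u) ⊞ u′)  ≡⟨ x⊞z⊟[y⊞z]≡x⊟y _ _ u′ ⟩
      σ→ (y ⊟ u) ⊟ σ→ (x ⊟ u)              ≡⟨ ⊟-hom σ σ-hom (y ⊟ u) (x ⊟ u) ⟨
      σ→ ((y ⊟ u) ⊟ (x ⊟ u))              ≡⟨ cong σ→ ([y⊟x]⊟[z⊟x]≡y⊟z u y x) ⟩
      σ→ (y ⊟ x)                          ∎
    where
    open ≡-Reasoning
    σ→ = Inverse.to σ

  affine-base : ∀ σ u u′ → IsGroupAut n σ → Inverse.to (affine-↔ σ u u′) u ≡ u′
  affine-base σ u u′ σ-hom = begin
      σ→ (u ⊟ u) ⊞ u′        ≡⟨ cong (_⊞ u′) (⊟-hom σ σ-hom u u) ⟩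
      σ→ u ⊟ σ→ u ⊞ u′       ≡⟨ cong (_⊞ u′) (⊟-self (σ→ u)) ⟩
      0ₙ ⊞ u′                ≡⟨ ⊞-identityˡ u′ ⟩
      u′                     ∎
    where
    open ≡-Reasoning
    σ→ = Inverse.to σ

module Units (n : ℕ) .{{_ : NonZero n}} where

  open ZMod n

  hasOrder⇒coprime : ∀ {s} → HasOrder n s n → Coprime (toℕ s) n
  hasOrder⇒coprime {s} (_ , _ , minimal) {d} (divides a s≡a*d , divides b n≡b*d) = d≡1 d n≡b*d
    where
    b∙s≡0ₙ : b ∙ s ≡ 0ₙ
    b∙s≡0ₙ = toℕ-injective-≋ (begin
      toℕ (b ∙ s)    ≈⟨ toℕ-∙ b s ⟩
      b * toℕ s      ≡⟨ cong (b *_) s≡a*d ⟩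
      b * (a * d)    ≡⟨ swap b a d ⟩
      a * (b * d)    ≡⟨ cong (a *_) n≡b*d ⟨
      a * n          ≈⟨ *-cong-≋ (≋-refl {a}) m≋0 ⟩
      a * 0          ≡⟨ trans (*-zeroʳ a) (sym toℕ-0ₙ) ⟩
      toℕ 0ₙ         ∎)
      where
      open ≋-Reasoning
      swap : ∀ b a d → b * (a * d) ≡ a * (b * d)
      swap = solve-∀
    d≡1 : ∀ d → n ≡ b * d → d ≡ 1
    d≡1 zero n≡b*0 = contradiction (trans n≡b*0 (*-zeroʳ b)) (≢-nonZero⁻¹ n)
    d≡1 (suc zero) _ = refl
    d≡1 (suc (suc e)) n≡b*d = contradiction b∙s≡0ₙ (minimal b 0<b b<n)
      where
      0<b : 0 < b
      0<b = n≢0⇒n>0 (λ b≡0 → ≢-nonZero⁻¹ n (trans n≡b*d (cong (_* suc (suc e)) b≡0)))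
      b<n : b < n
      b<n = subst (b <_) (sym n≡b*d) (m<m*n b (suc (suc e)) {{>-nonZero 0<b}} (s≤s (s≤s z≤n)))

  coprime⇒unit : ∀ {a} → Coprime a n → Unit a
  coprime⇒unit {a} coprime with coprime-Bézout coprime
  ... | Bézout.+- x y 1+y*n≡x*a = x , (begin
      x * a          ≡⟨ 1+y*n≡x*a ⟨
      1 + y * n      ≈⟨ +-congˡ-≋ 1 (*-cong-≋ (≋-refl {y}) m≋0) ⟩
      1 + y * 0      ≡⟨ cong suc (*-zeroʳ y) ⟩
      1              ∎)
    where open ≋-Reasoning
  ... | Bézout.-+ x y 1+x*a≡y*n = (n ∸ 1) * x , +-cancelʳ-≋ ((n ∸ 1) * x * a) 1 (n ∸ 1) (begin
      (n ∸ 1) * x * a + (n ∸ 1)   ≡⟨ factor (n ∸ 1) x a ⟩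
      (n ∸ 1) * (1 + x * a)       ≡⟨ cong ((n ∸ 1) *_) 1+x*a≡y*n ⟩
      (n ∸ 1) * (y * n)           ≈⟨ *-cong-≋ (≋-refl {n ∸ 1}) (*-cong-≋ (≋-refl {y}) m≋0) ⟩
      (n ∸ 1) * (y * 0)           ≡⟨ trans (cong ((n ∸ 1) *_) (*-zeroʳ y)) (*-zeroʳ (n ∸ 1)) ⟩
      0                           ≈⟨ m≋0 ⟨
      n                           ≡⟨ m+[n∸m]≡n (>-nonZero⁻¹ n) ⟨
      1 + (n ∸ 1)                 ∎)
    where
    open ≋-Reasoning
    factor : ∀ k x a → k * x * a + k ≡ k * (1 + x * a)
    factor = solve-∀

  hasOrder⇒unit : ∀ {s} → HasOrder n s n → Unit (toℕ s)
  hasOrder⇒unit = coprime⇒unit ∘ hasOrder⇒coprime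

  unit-*⇒unit : ∀ a b → Unit (a * b) → Unit a × Unit b
  unit-*⇒unit a b (u , u[ab]≋1) =
      (u * b , ≋-trans (≡⇒≋ (trans (*-assoc u b a) (cong (u *_) (*-comm b a)))) u[ab]≋1)
    , (u * a , ≋-trans (≡⇒≋ (*-assoc u a b)) u[ab]≋1)

  unit-ratio : ∀ {s t : Fin n} → Unit (toℕ s) → Unit (toℕ t) → ∃ λ k → Unit k × k ∙ s ≡ t
  unit-ratio {s} {t} (u , u*s≋1) (v , v*t≋1) = toℕ t * u , (toℕ s * v , k′*k≋1) , k∙s≡t
    where
    open ≋-Reasoning
    k′*k≋1 : toℕ s * v * (toℕ t * u) ≋ 1
    k′*k≋1 = begin
      toℕ s * v * (toℕ t * u)    ≡⟨ regroup (toℕ s) (toℕ t) u v ⟩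
      u * toℕ s * (v * toℕ t)    ≈⟨ *-cong-≋ u*s≋1 v*t≋1 ⟩
      1                          ∎
      where
      regroup : ∀ a b u v → a * v * (b * u) ≡ u * a * (v * b)
      regroup = solve-∀
    k∙s≡t : (toℕ t * u) ∙ s ≡ t
    k∙s≡t = toℕ-injective-≋ (begin
      toℕ ((toℕ t * u) ∙ s)    ≈⟨ toℕ-∙ (toℕ t * u) s ⟩
      toℕ t * u * toℕ s        ≡⟨ *-assoc (toℕ t) u (toℕ s) ⟩
      toℕ t * (u * toℕ s)      ≈⟨ *-cong-≋ (≋-refl {toℕ t}) u*s≋1 ⟩
      toℕ t * 1                ≡⟨ *-identityʳ (toℕ t) ⟩
      toℕ t                    ∎)

  unit⇒nonZero : 1 < n → ∀ {k} → Unit k → NonZero k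
  unit⇒nonZero 1<n {zero} (u , u*0≋1) =
    contradiction (≋⇒≡ (>-nonZero⁻¹ n) 1<n (≋-trans (≡⇒≋ (sym (*-zeroʳ u))) u*0≋1)) (λ ())
  unit⇒nonZero 1<n {suc k} _ = _

  ≢0ₙ⇒1<n : ∀ {s} → s ≢ 0ₙ → 1 < n
  ≢0ₙ⇒1<n {s} s≢0ₙ with 1 <? n
  ... | yes 1<n = 1<n
  ... | no 1≮n = contradiction (toℕ-injective (trans toℕs≡0 (sym toℕ-0ₙ))) s≢0ₙ
    where
    toℕs≡0 : toℕ s ≡ 0
    toℕs≡0 = n≤0⇒n≡0 (s≤s⁻¹ (≤-trans (toℕ<n s) (≮⇒≥ 1≮n)))

iverson : ∀ {a} {A : Set a} → Dec A → ℕ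
iverson (yes _) = 1
iverson (no _) = 0

indicator : ∀ {a} {A : Set a} {P : A → Set} → (∀ x → Dec (P x)) → A → ℕ
indicator P? x = iverson (P? x)

iverson≤1 : ∀ {a} {A : Set a} (a? : Dec A) → iverson a? ≤ 1
iverson≤1 (yes _) = s≤s z≤n
iverson≤1 (no _) = z≤n

iverson-cong : ∀ {a b} {A : Set a} {B : Set b} → (A → B) → (B → A) →
               (a? : Dec A) (b? : Dec B) → iverson a? ≡ iverson b?
iverson-cong A→B B→A (yes _) (yes _) = refl
iverson-cong A→B B→A (no _)  (no _)  = refl
iverson-cong A→B B→A (yes a) (no ¬b) = contradiction (A→B a) ¬b
iverson-cong A→B B→A (no ¬a) (yes b) = contradiction (B→A b) ¬a

iverson-≡⇒ : ∀ {a b} {A : Set a} {B : Set b} (a? : Dec A) (b? : Dec B) → iverson a? ≡ iverson b? → A → B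
iverson-≡⇒ (yes _) (yes b) _ _ = b
iverson-≡⇒ (no ¬a) _       _ a = contradiction a ¬a

sum-zero : ∀ {m} (f : Vector ℕ m) → (∀ i → f i ≡ 0) → sum f ≡ 0
sum-zero {m} f f≗0 = trans (sum-cong-≗ f≗0) (sum-replicate-zero m)

sum-single : ∀ {m} (f : Vector ℕ (suc m)) (i : Fin (suc m)) → (∀ j → j ≢ i → f j ≡ 0) → sum f ≡ f i
sum-single f i f≡0 = begin
    sum f                          ≡⟨ sum-remove f ⟩
    f i + sum (λ j → f (punchIn i j)) ≡⟨ cong (f i +_) (sum-zero _ (λ j → f≡0 (punchIn i j) (punchInᵢ≢i i j))) ⟩
    f i + 0                        ≡⟨ +-identityʳ (f i) ⟩
    f i                            ∎
  where open ≡-Reasoning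

δ : ∀ {m} → Fin m → Fin m → ℕ
δ a b = iverson (a ≟ᶠ b)

δ-refl : ∀ {m} (a : Fin m) → δ a a ≡ 1
δ-refl a with a ≟ᶠ a
... | yes _   = refl
... | no a≢a = contradiction refl a≢a

δ-≢ : ∀ {m} {a b : Fin m} → a ≢ b → δ a b ≡ 0
δ-≢ {a = a} {b} a≢b with a ≟ᶠ b
... | yes a≡b = contradiction a≡b a≢b
... | no _    = refl

δ-comm : ∀ {m} (a b : Fin m) → δ a b ≡ δ b a
δ-comm a b = iverson-cong sym sym (a ≟ᶠ b) (b ≟ᶠ a)

sum-δ : ∀ {m} (a : Fin m) (h : Fin m → ℕ) → sum (λ d → δ a d * h d) ≡ h a
sum-δ {suc m} a h = begin
    sum (λ d → δ a d * h d)  ≡⟨ sum-single _ a (λ d d≢a → cong (_* h d) (δ-≢ (λ a≡d → d≢a (sym a≡d)))) ⟩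
    δ a a * h a              ≡⟨ cong (_* h a) (δ-refl a) ⟩
    1 * h a                  ≡⟨ *-identityˡ (h a) ⟩
    h a                      ∎
  where open ≡-Reasoning

sum-δʳ : ∀ {m} (a : Fin m) (h : Fin m → ℕ) → sum (λ d → h d * δ d a) ≡ h a
sum-δʳ a h = trans (sum-cong-≗ (λ d → trans (*-comm (h d) (δ d a)) (cong (_* h d) (δ-comm d a)))) (sum-δ a h)

module Convolution (n : ℕ) .{{_ : NonZero n}} where

  open ZMod n

  infixl 7 _⋆_
  _⋆_ : (Fin n → ℕ) → (Fin n → ℕ) → Fin n → ℕ
  (f ⋆ g) v = sum (λ d → f d * g (v ⊟ d))

  ⋆-comm : ∀ f g v → (f ⋆ g) v ≡ (g ⋆ f) v
  ⋆-comm f g v = begin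
      sum (λ d → f d * g (v ⊟ d))                ≡⟨ ∑-permute (λ d → f d * g (v ⊟ d)) (reflect-↔ v) ⟩
      sum (λ e → f (v ⊟ e) * g (v ⊟ (v ⊟ e)))    ≡⟨ sum-cong-≗ (λ e → cong (f (v ⊟ e) *_) (cong g (x⊟[x⊟y]≡y v e))) ⟩
      sum (λ e → f (v ⊟ e) * g e)                ≡⟨ sum-cong-≗ (λ e → *-comm (f (v ⊟ e)) (g e)) ⟩
      sum (λ e → g e * f (v ⊟ e))                ∎
    where open ≡-Reasoning

  ⋆-assoc : ∀ f g h v → ((f ⋆ g) ⋆ h) v ≡ (f ⋆ (g ⋆ h)) v
  ⋆-assoc f g h v = begin
      sum (λ a → sum (λ b → f b * g (a ⊟ b)) * h (v ⊟ a))
        ≡⟨ sum-cong-≗ (λ a → *-distribʳ-sum (h (v ⊟ a)) (λ b → f b * g (a ⊟ b))) ⟩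
      sum (λ a → sum (λ b → f b * g (a ⊟ b) * h (v ⊟ a)))
        ≡⟨ ∑-comm (λ a b → f b * g (a ⊟ b) * h (v ⊟ a)) ⟩
      sum (λ b → sum (λ a → f b * g (a ⊟ b) * h (v ⊟ a)))
        ≡⟨ sum-cong-≗ (λ b → ∑-permute (λ a → f b * g (a ⊟ b) * h (v ⊟ a)) (⊞-↔ b)) ⟩
      sum (λ b → sum (λ c → f b * g (b ⊞ c ⊟ b) * h (v ⊟ (b ⊞ c))))
        ≡⟨ sum-cong-≗ (λ b → sum-cong-≗ (λ c → reassociate b c)) ⟩
      sum (λ b → sum (λ c → f b * (g c * h (v ⊟ b ⊟ c))))
        ≡⟨ sum-cong-≗ (λ b → *-distribˡ-sum (f b) (λ c → g c * h (v ⊟ b ⊟ c))) ⟨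
      sum (λ b → f b * sum (λ c → g c * h (v ⊟ b ⊟ c)))
        ∎
    where
    open ≡-Reasoning
    reassociate : ∀ b c → f b * g (b ⊞ c ⊟ b) * h (v ⊟ (b ⊞ c)) ≡ f b * (g c * h (v ⊟ b ⊟ c))
    reassociate b c = trans (cong₂ (λ x y → f b * g x * h y) (y⊞x⊟y≡x c b) (x⊟[y⊞z]≡x⊟y⊟z v b c))
                            (*-assoc (f b) (g c) (h (v ⊟ b ⊟ c)))

  ⋆-identityˡ : ∀ f v → (δ 0ₙ ⋆ f) v ≡ f v
  ⋆-identityˡ f v = trans (sum-δ 0ₙ (λ d → f (v ⊟ d))) (cong f (⊟-identityʳ v))

  ⋆-distribʳ-+ : ∀ f g h v → ((λ x → g x + h x) ⋆ f) v ≡ (g ⋆ f) v + (h ⋆ f) v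
  ⋆-distribʳ-+ f g h v = trans (sum-cong-≗ (λ d → *-distribʳ-+ (f (v ⊟ d)) (g d) (h d)))
                               (∑-distrib-+ (λ d → g d * f (v ⊟ d)) (λ d → h d * f (v ⊟ d)))

  ⋆-zeroˡ : ∀ f v → ((λ _ → 0) ⋆ f) v ≡ 0
  ⋆-zeroˡ f v = sum-zero (λ (d : Fin n) → 0) (λ _ → refl)

  δ⋆δ : ∀ a b v → (δ a ⋆ δ b) v ≡ δ (a ⊞ b) v
  δ⋆δ a b v = trans (sum-δ a (λ d → δ b (v ⊟ d)))
    (iverson-cong (λ b≡v⊟a → trans (cong (a ⊞_) b≡v⊟a) (y⊞[x⊟y]≡x v a))
                  (λ a⊞b≡v → trans (sym (y⊞x⊟y≡x b a)) (cong (_⊟ a) a⊞b≡v)) _ _)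

  sum-indicator-δ-∙ : ∀ {k} (ku : Unit k) {P : Fin n → Set} (P? : ∀ v → Dec (P v)) v →
                      sum (λ d → indicator P? d * δ (k ∙ d) v) ≡ indicator (Scaled? k P?) v
  sum-indicator-δ-∙ {k} (u , uk≋1) P? v = begin
      sum (λ d → χ d * δ (k ∙ d) v)   ≡⟨ sum-cong-≗ (λ d → cong (λ e → χ e * δ (k ∙ d) v) (∙-inverse u k uk≋1 d)) ⟨
      sum (λ d → F (k ∙ d))           ≡⟨ ∑-permute F (∙-↔ (u , uk≋1)) ⟨
      sum F                           ≡⟨ sum-δʳ v (λ w → χ (u ∙ w)) ⟩
      χ (u ∙ v)                       ≡⟨ iverson-cong to from (P? (u ∙ v)) (Scaled? k P? v) ⟩
      indicator (Scaled? k P?) v      ∎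
    where
    open ≡-Reasoning
    open Equivalence (Scaled-unit⇔ (u , uk≋1) v)
    χ = indicator P?
    F : Fin n → ℕ
    F w = χ (u ∙ w) * δ w v

  module ModP (p : ℕ) .{{_ : NonZero p}} where

    module P = Congruence p
    open P using () renaming (_≋_ to _≋ₚ_)

    infix 4 _≈_
    _≈_ : (Fin n → ℕ) → (Fin n → ℕ) → Set
    f ≈ g = ∀ v → f v ≋ₚ g v

    ≗⇒≈ : ∀ {f g} → (∀ v → f v ≡ g v) → f ≈ g
    ≗⇒≈ f≗g v = P.≡⇒≋ (f≗g v)

    ⋆-cong : ∀ {f g h k} → f ≈ g → h ≈ k → f ⋆ h ≈ g ⋆ k
    ⋆-cong {f} {g} {h} {k} f≈g h≈k v = sum-cong-≋ (λ d → P.*-cong-≋ (f≈g d) (h≈k (v ⊟ d)))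
      where
      sum-cong-≋ : ∀ {m} {a b : Vector ℕ m} → (∀ i → a i ≋ₚ b i) → sum a ≋ₚ sum b
      sum-cong-≋ {zero}  a≋b = P.mk≋ refl
      sum-cong-≋ {suc m} a≋b = P.+-cong-≋ (a≋b Fin.zero) (sum-cong-≋ (λ i → a≋b (Fin.suc i)))

    -- the group semiring ℕ[ℤₙ] reduced modulo p
    convolutionSemiring : CommutativeSemiring 0ℓ 0ℓ
    convolutionSemiring = record
      { Carrier = Fin n → ℕ
      ; _≈_ = _≈_
      ; _+_ = λ f g v → f v + g v
      ; _*_ = _⋆_
      ; 0# = λ _ → 0
      ; 1# = δ 0ₙ
      ; isCommutativeSemiring = IsCommutativeSemiringˡ.isCommutativeSemiring (record
        { +-isCommutativeMonoid = isCommutativeMonoidˡ (record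
          { isSemigroup = record
            { isMagma = record
              { isEquivalence = ≈-isEquivalence
              ; ∙-cong = λ f≈g h≈k v → P.+-cong-≋ (f≈g v) (h≈k v) }
            ; assoc = λ f g h → ≗⇒≈ (λ v → +-assoc (f v) (g v) (h v)) }
          ; identityˡ = λ f → ≗⇒≈ (λ v → refl)
          ; comm = λ f g → ≗⇒≈ (λ v → +-comm (f v) (g v)) })
        ; *-isCommutativeMonoid = isCommutativeMonoidˡ (record
          { isSemigroup = record
            { isMagma = record { isEquivalence = ≈-isEquivalence ; ∙-cong = ⋆-cong }
            ; assoc = λ f g h → ≗⇒≈ (⋆-assoc f g h) }
          ; identityˡ = λ f → ≗⇒≈ (⋆-identityˡ f)
          ; comm = λ f g → ≗⇒≈ (⋆-comm f g) })
        ; distribʳ = λ f g h → ≗⇒≈ (⋆-distribʳ-+ f g h)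
        ; zeroˡ = λ f → ≗⇒≈ (⋆-zeroˡ f) })
      }
      where
      ≈-isEquivalence = Pointwise.isEquivalence (Fin n) (Setoid.isEquivalence P.≋-setoid)

    open CommutativeSemiring convolutionSemiring using (semiring; +-monoid) renaming (trans to ≈-trans)
    open import Algebra.Properties.Semiring.Exp semiring public using (_^_)
    open import Algebra.Properties.Semiring.Exp semiring using (^-congˡ; ^-congʳ)
    open import Algebra.Properties.Monoid.Mult +-monoid using () renaming (_×_ to _×ᶜ_)
    open import Algebra.Properties.Monoid.Sum +-monoid using () renaming (sum to sumᶜ; sum-cong-≋ to sumᶜ-cong-≋)
    open Frobenius convolutionSemiring using (frobenius-sum)

    ×-pointwise : ∀ k f v → (k ×ᶜ f) v ≡ k * f v
    ×-pointwise zero    f v = refl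
    ×-pointwise (suc k) f v = cong (f v +_) (×-pointwise k f v)

    p×≈0 : ∀ f → p ×ᶜ f ≈ (λ _ → 0)
    p×≈0 f v = P.≋-trans (P.≡⇒≋ (×-pointwise p f v)) (P.*-cong-≋ P.m≋0 (P.≋-refl {f v}))

    sumᶜ-pointwise : ∀ {k} (t : Vector (Fin n → ℕ) k) v → sumᶜ t v ≡ sum (λ i → t i v)
    sumᶜ-pointwise {zero}  t v = refl
    sumᶜ-pointwise {suc k} t v = cong (t Fin.zero v +_) (sumᶜ-pointwise (λ i → t (Fin.suc i)) v)

    δ-^ : ∀ k a v → (δ a ^ k) v ≡ δ (k ∙ a) v
    δ-^ zero    a v = refl
    δ-^ (suc k) a v = begin
      (δ a ⋆ δ a ^ k) v      ≡⟨ sum-cong-≗ (λ d → cong (δ a d *_) (δ-^ k a (v ⊟ d))) ⟩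
      (δ a ⋆ δ (k ∙ a)) v    ≡⟨ δ⋆δ a (k ∙ a) v ⟩
      δ (a ⊞ k ∙ a) v        ≡⟨ cong (λ b → δ b v) (suc-∙ k a) ⟨
      δ (suc k ∙ a) v        ∎
      where open ≡-Reasoning

    -- For a 0/1-valued χ, (χ ^ l) (y ⊟ x) counts the walks of length l from x to y in Circ(n, χ).
    ^-suc-walks : ∀ χ l x y → (χ ^ suc l) (y ⊟ x) ≡ sum (λ z → χ (z ⊟ x) * (χ ^ l) (y ⊟ z))
    ^-suc-walks χ l x y = trans (∑-permute (λ d → χ d * (χ ^ l) (y ⊟ x ⊟ d)) (⊟-↔ x))
      (sum-cong-≗ (λ z → cong (λ w → χ (z ⊟ x) * (χ ^ l) w) ([y⊟x]⊟[z⊟x]≡y⊟z x y z)))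

    ^-invariant : ∀ (φ : Fin n ↔ Fin n) χ →
                  (∀ x y → χ (Inverse.to φ y ⊟ Inverse.to φ x) ≡ χ (y ⊟ x)) →
                  ∀ l x y → (χ ^ l) (Inverse.to φ y ⊟ Inverse.to φ x) ≡ (χ ^ l) (y ⊟ x)
    ^-invariant φ χ χ-inv zero x y = iverson-cong
      (λ 0≡φy⊟φx → trans (sym (⊟-self x)) (cong (_⊟ x) (sym (φ-injective (⊟≡0ₙ⇒≡ (sym 0≡φy⊟φx))))))
      (λ 0≡y⊟x → trans (sym (⊟-self (φ→ x))) (cong (λ w → φ→ w ⊟ φ→ x) (sym (⊟≡0ₙ⇒≡ (sym 0≡y⊟x))))) _ _
      where
      φ→ = Inverse.to φ
      φ-injective = Injection.injective (↔⇒↣ φ)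
    ^-invariant φ χ χ-inv (suc l) x y = begin
      (χ ^ suc l) (φ→ y ⊟ φ→ x)                            ≡⟨ ^-suc-walks χ l (φ→ x) (φ→ y) ⟩
      sum (λ z → χ (z ⊟ φ→ x) * (χ ^ l) (φ→ y ⊟ z))         ≡⟨ ∑-permute (λ z → χ (z ⊟ φ→ x) * (χ ^ l) (φ→ y ⊟ z)) φ ⟩
      sum (λ w → χ (φ→ w ⊟ φ→ x) * (χ ^ l) (φ→ y ⊟ φ→ w))   ≡⟨ sum-cong-≗ (λ w → cong₂ _*_ (χ-inv x w) (^-invariant φ χ χ-inv l w y)) ⟩
      sum (λ w → χ (w ⊟ x) * (χ ^ l) (y ⊟ w))               ≡⟨ ^-suc-walks χ l x y ⟨
      (χ ^ suc l) (y ⊟ x)                                   ∎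
      where
      open ≡-Reasoning
      φ→ = Inverse.to φ

    -- Write the indicator of P as the sum of the δ d with d ∈ P; in characteristic p the p-th power
    -- of that sum is the sum of the δ d ^ p = δ (p ∙ d).
    indicator-^-prime : Prime p → (pu : Unit p) → ∀ {P : Fin n → Set} (P? : ∀ v → Dec (P v)) →
                        indicator P? ^ p ≈ indicator (Scaled? p P?)
    indicator-^-prime p-prime (u , up≋1) {P} P? = begin
        χ ^ p                ≈⟨ ^-congˡ p (≗⇒≈ (λ v → sym (trans (sumᶜ-pointwise g v) (sum-δʳ v χ)))) ⟩
        sumᶜ g ^ p           ≈⟨ frobenius-sum p-prime p×≈0 g ⟩
        sumᶜ (λ d → g d ^ p) ≈⟨ sumᶜ-cong-≋ (λ d → weighted-δ-^ (χ d) (iverson≤1 (P? d)) d) ⟩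
        sumᶜ h               ≈⟨ ≗⇒≈ (λ v → trans (sumᶜ-pointwise h v) (sum-indicator-δ-∙ (u , up≋1) P? v)) ⟩
        indicator (Scaled? p P?) ∎
      where
      open import Relation.Binary.Reasoning.Setoid (CommutativeSemiring.setoid convolutionSemiring)
      χ = indicator P?
      g h : Fin n → Fin n → ℕ
      g d v = χ d * δ d v
      h d v = χ d * δ (p ∙ d) v
      weighted-δ-^ : ∀ c → c ≤ 1 → ∀ d → (λ v → c * δ d v) ^ p ≈ (λ v → c * δ (p ∙ d) v)
      weighted-δ-^ zero _ d = ≈-trans (^-congʳ (λ _ → 0) (sym (suc-pred p))) (≗⇒≈ (⋆-zeroˡ ((λ _ → 0) ^ pred p)))
      weighted-δ-^ (suc zero) _ d = ≈-trans (^-congˡ p (≗⇒≈ (λ v → +-identityʳ (δ d v))))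
                                            (≗⇒≈ (λ v → trans (δ-^ p d v) (sym (+-identityʳ _))))
      weighted-δ-^ (suc (suc _)) (s≤s ()) d

module Circulant (n : ℕ) .{{_ : NonZero n}} (S : Subset n) where

  open ZMod n
  open Convolution n
  open Units n

  AutInvariant : (Fin n → Set) → Set
  AutInvariant P = ∀ φ → IsCircAut n S φ → ∀ x y →
                   P (y ⊟ x) ⇔ P (Inverse.to φ y ⊟ Inverse.to φ x)

  ∈S-autInvariant : AutInvariant (_∈ S)
  ∈S-autInvariant φ φ-aut = φ-aut

  autInvariant-resp-⇔ : ∀ {P Q : Fin n → Set} → (∀ v → P v ⇔ Q v) → AutInvariant P → AutInvariant Q
  autInvariant-resp-⇔ P⇔Q P-inv φ φ-aut x y = mk⇔
    (λ Q[y⊟x] → to (P⇔Q _) (to (P-inv φ φ-aut x y) (from (P⇔Q _) Q[y⊟x])))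
    (λ Q[φy⊟φx] → to (P⇔Q _) (from (P-inv φ φ-aut x y) (from (P⇔Q _) Q[φy⊟φx])))
    where open Equivalence

  Scaled-prime-autInvariant : ∀ {P : Fin n → Set} → (∀ v → Dec (P v)) → AutInvariant P →
                              ∀ {p} → Prime p → Unit p → AutInvariant (Scaled p P)
  Scaled-prime-autInvariant {P} P? P-inv {p} p-prime pu φ φ-aut x y =
    mk⇔ (iverson-≡⇒ (Q? (y ⊟ x)) (Q? (φ→ y ⊟ φ→ x)) (sym χQ-inv))
        (iverson-≡⇒ (Q? (φ→ y ⊟ φ→ x)) (Q? (y ⊟ x)) χQ-inv)
    where
    instance _ = prime⇒nonZero p-prime
    open ModP p
    1<p = nonTrivial⇒n>1 p {{prime⇒nonTrivial p-prime}}
    φ→ = Inverse.to φ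
    χ = indicator P?
    Q? = Scaled? p P?
    χ-inv : ∀ x y → χ (φ→ y ⊟ φ→ x) ≡ χ (y ⊟ x)
    χ-inv x y = iverson-cong (from (P-inv φ φ-aut x y)) (to (P-inv φ φ-aut x y)) _ _
      where open Equivalence
    -- both sides are 0 or 1, and 1 < p, so congruence modulo p is equality
    χQ-inv : indicator Q? (φ→ y ⊟ φ→ x) ≡ indicator Q? (y ⊟ x)
    χQ-inv = P.≋⇒≡ (≤-<-trans (iverson≤1 _) 1<p) (≤-<-trans (iverson≤1 _) 1<p) (begin
      indicator Q? (φ→ y ⊟ φ→ x)   ≈⟨ indicator-^-prime p-prime pu P? (φ→ y ⊟ φ→ x) ⟨
      (χ ^ p) (φ→ y ⊟ φ→ x)        ≡⟨ ^-invariant φ χ χ-inv p x y ⟩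
      (χ ^ p) (y ⊟ x)              ≈⟨ indicator-^-prime p-prime pu P? (y ⊟ x) ⟩
      indicator Q? (y ⊟ x)         ∎)
      where open P.≋-Reasoning

  Scaled-product-autInvariant : ∀ {P : Fin n → Set} → (∀ v → Dec (P v)) → AutInvariant P →
                                ∀ ps → All Prime ps → Unit (product ps) → AutInvariant (Scaled (product ps) P)
  Scaled-product-autInvariant P? P-inv [] [] _ = autInvariant-resp-⇔ Scaled-identity P-inv
  Scaled-product-autInvariant P? P-inv (p ∷ ps) (p-prime ∷ ps-prime) u
    with unit-*⇒unit p (product ps) u
  ... | pu , psu = autInvariant-resp-⇔ (Scaled-assoc p (product ps))
        (Scaled-prime-autInvariant (Scaled? (product ps) P?)
          (Scaled-product-autInvariant P? P-inv ps ps-prime psu) p-prime pu)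

  Scaled-unit-autInvariant : ∀ k .{{_ : NonZero k}} → Unit k → AutInvariant (Scaled k (_∈ S))
  Scaled-unit-autInvariant k ku =
    subst (λ m → AutInvariant (Scaled m (_∈ S))) (sym k≡∏)
      (Scaled-product-autInvariant (_∈? S) ∈S-autInvariant factors factorsPrime (subst Unit k≡∏ ku))
    where open PrimeFactorisation (factorise k) renaming (isFactorisation to k≡∏)

  autInvariant-meeting-S-contains-S : ArcTransitive n S → ∀ {Q} → AutInvariant Q →
                                      ∀ {t} → t ∈ S → Q t → ∀ {w} → w ∈ S → Q w
  autInvariant-meeting-S-contains-S arcTransitive {Q} Q-inv {t} t∈S Qt {w} w∈S
    with arcTransitive 0ₙ t 0ₙ w (subst (_∈ S) (sym (⊟-identityʳ t)) t∈S) (subst (_∈ S) (sym (⊟-identityʳ w)) w∈S)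
  ... | φ , φ-aut , φ0≡0 , φt≡w = subst Q (trans (cong₂ _⊟_ φt≡w φ0≡0) (⊟-identityʳ w))
          (Equivalence.to (Q-inv φ φ-aut 0ₙ t) (subst Q (sym (⊟-identityʳ t)) Qt))

  S⊆kS : ArcTransitive n S → 1 < n → ∀ {k} → Unit k → ∀ {s} → s ∈ S → k ∙ s ∈ S →
         ∀ {w} → w ∈ S → Scaled k (_∈ S) w
  S⊆kS arcTransitive 1<n {k} ku {s} s∈S ks∈S = autInvariant-meeting-S-contains-S arcTransitive
    (Scaled-unit-autInvariant k {{unit⇒nonZero 1<n ku}} ku) ks∈S (s , s∈S , refl)

  normal⇒arc : NormalArcTransitive n S → ArcTransitive n S
  normal⇒arc normal u v u′ v′ u→v u′→v′ with normal (v ⊟ u) (v′ ⊟ u′) u→v u′→v′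
  ... | σ , (σ-hom , σ-preserves) , σ[v⊟u]≡v′⊟u′ =
    affine-↔ σ u u′ , φ-aut , affine-base σ u u′ σ-hom , trans (cong (_⊞ u′) σ[v⊟u]≡v′⊟u′) (x⊟y⊞y≡x v′ u′)
    where
    open Equivalence
    φ-aut : IsCircAut n S (affine-↔ σ u u′)
    φ-aut x y = mk⇔
      (λ y⊟x∈S → subst (_∈ S) (sym (affine-⊟ σ u u′ σ-hom x y)) (to (σ-preserves (y ⊟ x)) y⊟x∈S))
      (λ φy⊟φx∈S → from (σ-preserves (y ⊟ x)) (subst (_∈ S) (affine-⊟ σ u u′ σ-hom x y) φy⊟φx∈S))

  unit-preserves-S : ArcTransitive n S → 1 < n → ∀ {k} (ku : Unit k) {s t} → s ∈ S → t ∈ S → k ∙ s ≡ t →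
                     ∀ x → x ∈ S ⇔ k ∙ x ∈ S
  unit-preserves-S arcTransitive 1<n {k} ku@(k′ , k′*k≋1) {s} {t} s∈S t∈S k∙s≡t x = mk⇔
      (λ x∈S → from (Scaled-unit⇔ k′u x) (S⊆kS arcTransitive 1<n k′u t∈S (subst (_∈ S) (sym k′∙t≡s) s∈S) x∈S))
      (λ kx∈S → subst (_∈ S) (∙-inverse k′ k k′*k≋1 x)
                  (from (Scaled-unit⇔ ku (k ∙ x)) (S⊆kS arcTransitive 1<n ku s∈S (subst (_∈ S) (sym k∙s≡t) t∈S) kx∈S)))
    where
    open Equivalence
    k′u = unit-inverse ku
    k′∙t≡s : k′ ∙ t ≡ s
    k′∙t≡s = trans (cong (k′ ∙_) (sym k∙s≡t)) (∙-inverse k′ k k′*k≋1 s)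

  arc⇒normal : 𝟘 n ∉ S → (∀ s → s ∈ S → HasOrder n s n) → ArcTransitive n S → NormalArcTransitive n S
  arc⇒normal 0∉S order arcTransitive s t s∈S t∈S =
    scaling (unit-ratio (hasOrder⇒unit (order s s∈S)) (hasOrder⇒unit (order t t∈S)))
    where
    1<n = ≢0ₙ⇒1<n (λ s≡0ₙ → 0∉S (subst (_∈ S) s≡0ₙ s∈S))
    -- a helper rather than `with`, whose abstraction would normalise the Bézout coefficients
    scaling : (∃ λ k → Unit k × k ∙ s ≡ t) → Σ (Fin n ↔ Fin n) λ σ → IsAutZnS n S σ × (Inverse.to σ s ≡ t)
    scaling (k , ku , k∙s≡t) =
      ∙-↔ ku , (∙-distribˡ-⊞ k , unit-preserves-S arcTransitive 1<n ku s∈S t∈S k∙s≡t) , k∙s≡t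

corollary1p2 : (n : ℕ) .{{_ : NonZero n}} (S : Subset n) →
    𝟘 n ∉ S →
    (∀ s → s ∈ S → HasOrder n s n) →
    ArcTransitive n S ⇔ NormalArcTransitive n S
corollary1p2 n S 0∉S order = mk⇔ (arc⇒normal 0∉S order) normal⇒arc
  where open Circulant n S
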